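{- Let \(\Gamma = (G,B)\) be a graph with dangling edges and \((Y,r)\) be a rank decomposition of \(G\). Then there is an inductive rank decomposition \(T\) of \(\Gamma\) such that \(\mathrm{width}(T) \leq \mathrm{width}(Y,r) + \operatorname{rank}(B)\).
   Context: A graph with dangling edges \(\Gamma = (G,B)\) consists of an adjacency matrix \(G \in \mathrm{Mat}_{\mathbb{N}}(k,k)\) of a graph on \(k\) vertices (taken up to the equivalence \([G]=[H]\) iff \(G + G^{T} = H + H^{T}\)) and a matrix \(B \in \mathrm{Mat}_{\mathbb{N}}(k,n)\) recording "dangling edges" from the vertices to \(n\) boundary ports. A rank decomposition \((Y,r)\) of a graph \(G\) is a subcubic tree \(Y\) (every vertex has at most three neighbours) with a bijection \(r\) from the leaves of \(Y\) to the vertices of \(G\). Each edge \(b\) of \(Y\) splits the leaves into two sets, hence gives a 2-partition \(\{A_b,B_b\}\) of the vertices of \(G\); let \(X_b\) be the matrix whose \((i,j)\)-entry is the number of edges of \(G\) between \(v_i \in A_b\) and \(v_j \in B_b\). The order of \(b\) is \(\operatorname{rank}(X_b)\), and \(\mathrm{width}(Y,r)\) is the maximum order of an edge of \(Y\). The rank width of \(G\) is the minimum width of its rank decompositions. An inductive rank decomposition of \(\Gamma = (G,B)\), with \(G \in \mathrm{Mat}_{\mathbb{N}}(k,k)\), \(B \in \mathrm{Mat}_{\mathbb{N}}(k,n)\), is a binary tree whose nodes are labelled by nonempty subgraphs of \(\Gamma\), such that either: \(\Gamma\) is empty and \(T\) is the empty tree; or \(\Gamma\) has one vertex and \(T\)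 is a single leaf labelled \(\Gamma\); or \(T\) has root labelled \(\Gamma\) with two subtrees \(T_1, T_2\) that are inductive rank decompositions of subgraphs \(\Gamma_i = (G_i,B_i)\) with \([G] = \left[\begin{pmatrix} G_1 & C \\ 0 & G_2\end{pmatrix}\right]\), \(B = \begin{pmatrix} A_1 \\ A_2\end{pmatrix}\), \(B_1 = (A_1 \mid C)\) and \(B_2 = (A_2 \mid C^{T})\). Its width is defined inductively by \(\mathrm{width}(\text{empty}) = 0\) and \(\mathrm{width}(T) = \max\{\mathrm{width}(T_1), \mathrm{width}(T_2), \operatorname{rank}(B)\}\), i.e. the maximum over full subtrees \(T'\) of the rank of the boundary matrix of the subgraph labelling the root of \(T'\). -}

module Defs where

open import Data.Nat using (ℕ; zero; suc; _+_)
open import Data.Integer using (+_)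
open import Data.Rational using (ℚ; 0ℚ; _/_) renaming (_+_ to _+ℚ_; _*_ to _*ℚ_)
open import Data.Fin using (Fin; splitAt; _≟_) renaming (zero to fzero; suc to fsuc)
open import Data.Sum using (_⊎_; inj₁; inj₂; [_,_]′)
open import Data.Bool using (Bool; true; false; if_then_else_; _∧_; not)
open import Data.List using (List; []; _∷_; _++_; allFin)
open import Data.Bool.ListAction using (any)
open import Data.List.Relation.Binary.Permutation.Propositional using (_↭_)
open import Data.Product using (_×_; _,_)
open import Data.Unit using (⊤)
open import Relation.Nullary using (¬_)
open import Relation.Nullary.Decidable using (⌊_⌋)
open import Relation.Binary.PropositionalEquality using (_≡_)
open import Function.Definitions using (Injective; Bijective)

Mat : ℕ → ℕ → Set
Mat m n = Fin m → Fin n → ℕ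

toℚ : ℕ → ℚ
toℚ n = (+ n) / 1

∑ : (r : ℕ) → (Fin r → ℚ) → ℚ
∑ zero    f = 0ℚ
∑ (suc r) f = f fzero +ℚ ∑ r (λ i → f (fsuc i))

LinearlyIndependent : ∀ {r n} → (Fin r → Fin n → ℚ) → Set
LinearlyIndependent {r} {n} v =
  ∀ (c : Fin r → ℚ) →
    (∀ (j : Fin n) → ∑ r (λ i → c i *ℚ v i j) ≡ 0ℚ) →
    ∀ (i : Fin r) → c i ≡ 0ℚ

-- rank X ≤ ρ  (rank = maximal number of linearly independent rows over ℚ):
-- no ρ+1 distinct rows of X are linearly independent.
RankAtMost : ∀ {m n} → Mat m n → ℕ → Set
RankAtMost {m} X ρ =
  ∀ (f : Fin (suc ρ) → Fin m) → Injective _≡_ _≡_ f →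
    ¬ LinearlyIndependent (λ i j → toℚ (X (f i) j))

-- Graphs with dangling edges: G : Mat k k (adjacency, only G + Gᵀ matters),
-- B : Mat k n (dangling edges).  Number of edges between vertices i ≠ j:

edges : ∀ {k} → Mat k k → Fin k → Fin k → ℕ
edges G i j = G i j + G j i

-- A subcubic tree with at least two vertices is presented by choosing one
-- leaf ℓ; removing ℓ leaves a tree rooted at the neighbour of ℓ in which
-- every vertex has at most two children (degree ≤ 3).  Leaves (vertices of
-- degree ≤ 1) carry their label r(leaf) ∈ Fin k.

data STree (k : ℕ) : Set where
  leaf  : Fin k → STree k
  node1 : STree k → STree k
  node2 : STree k → STree k → STree k

data SubcubicTree (k : ℕ) : Set where
  -- the one-vertex tree, its single vertex being a leaf
  single : Fin k → SubcubicTree k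
  rooted : Fin k → STree k → SubcubicTree k

leavesS : ∀ {k} → STree k → List (Fin k)
leavesS (leaf v)      = v ∷ []
leavesS (node1 t)     = leavesS t
leavesS (node2 t₁ t₂) = leavesS t₁ ++ leavesS t₂

leaves : ∀ {k} → SubcubicTree k → List (Fin k)
leaves (single v)   = v ∷ []
leaves (rooted v t) = v ∷ leavesS t

-- (Y , r) is a rank decomposition: r is a bijection leaves → vertices,
-- i.e. the list of leaf labels is a permutation of all vertices.
IsRankDecomposition : ∀ {k} → SubcubicTree k → Set
IsRankDecomposition {k} Y = leaves Y ↭ allFin k

data _⊑_ {k : ℕ} : STree k → STree k → Set where
  here   : ∀ {t} → t ⊑ t
  in1    : ∀ {s t} → s ⊑ t → s ⊑ node1 t
  in2ˡ   : ∀ {s t u} → s ⊑ t → s ⊑ node2 t u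
  in2ʳ   : ∀ {s t u} → s ⊑ u → s ⊑ node2 t u

_∈ᵇ_ : ∀ {k} → Fin k → List (Fin k) → Bool
v ∈ᵇ xs = any (λ x → ⌊ x ≟ v ⌋) xs

-- X_b for the 2-partition {A , V∖A}: entry (i,j) is the number of edges
-- between i ∈ A and j ∉ A; rows outside A / columns inside A are zero
-- (zero rows/columns do not change the rank).
cutMatrix : ∀ {k} → Mat k k → List (Fin k) → Mat k k
cutMatrix G A i j = if (i ∈ᵇ A) ∧ not (j ∈ᵇ A) then edges G i j else 0

-- The edges of Y = (rooted ℓ t) are in bijection with the subtrees s ⊑ t
-- (edge from the root of s to its parent, or to ℓ when s = t); the
-- partition it induces is {leaves s , rest}.
-- width (Y , r) ≤ w :
RDWidthAtMost : ∀ {k} → Mat k k → SubcubicTree k → ℕ → Set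
RDWidthAtMost G (single v)   w = ⊤
RDWidthAtMost G (rooted v t) w =
  ∀ (s : STree _) → s ⊑ t → RankAtMost (cutMatrix G (leavesS s)) w

_∣∣_ : ∀ {m n p} → Mat m n → Mat m p → Mat m (n + p)
_∣∣_ {n = n} A C i j = [ A i , C i ]′ (splitAt n j)

module _ {k₁ k₂ k : ℕ} (σ : Fin k₁ ⊎ Fin k₂ → Fin k) where
  -- σ identifies the vertices of Γ with the disjoint union of those of
  -- Γ₁ and Γ₂ (the block decomposition up to reordering of vertices)
  restrict₁ : Mat k k → Mat k₁ k₁
  restrict₁ G i j = G (σ (inj₁ i)) (σ (inj₁ j))

  restrict₂ : Mat k k → Mat k₂ k₂
  restrict₂ G i j = G (σ (inj₂ i)) (σ (inj₂ j))

  rows₁ : ∀ {n} → Mat k n → Mat k₁ n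
  rows₁ B i = B (σ (inj₁ i))

  rows₂ : ∀ {n} → Mat k n → Mat k₂ n
  rows₂ B i = B (σ (inj₂ i))

  between : Mat k k → Mat k₁ k₂
  between G i j = edges G (σ (inj₁ i)) (σ (inj₂ j))

transpose : ∀ {m n} → Mat m n → Mat n m
transpose C i j = C j i

data IRD : (k n : ℕ) → Mat k k → Mat k n → Set where
  empty  : ∀ {n G B} → IRD 0 n G B
  single : ∀ {n G B} → IRD 1 n G B
  split  : ∀ {k n G B} (k₁ k₂ : ℕ) (σ : Fin k₁ ⊎ Fin k₂ → Fin k) →
           Bijective _≡_ _≡_ σ →
           IRD k₁ (n + k₂) (restrict₁ σ G) (rows₁ σ B ∣∣ between σ G) →
           IRD k₂ (n + k₁) (restrict₂ σ G) (rows₂ σ B ∣∣ transpose (between σ G)) →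
           IRD k n G B

IRDWidthAtMost : ∀ {k n G B} → IRD k n G B → ℕ → Set
IRDWidthAtMost empty w = ⊤
IRDWidthAtMost {B = B} single w = RankAtMost B w
IRDWidthAtMost {B = B} (split k₁ k₂ σ _ T₁ T₂) w =
  RankAtMost B w × IRDWidthAtMost T₁ w × IRDWidthAtMost T₂ w

-- Root Y at its presented leaf ℓ.  Split Γ into ℓ and the other leaves, and
-- then, at every binary node s of the rooted tree, into the leaves of the two
-- subtrees of s.  The boundary matrix at s is, after reindexing rows and
-- columns, a submatrix of (B | X_b) for the edge b of Y above s, and rank is
-- subadditive under concatenation, so it has rank at most ρ + w.  The node {ℓ}
-- has a single row, which is zero when ρ = w = 0.
--
-- Subadditivity: rows of rank at most a lie (under ¬ ¬) in the span of at most
-- a vectors, and more than m vectors in a span of m vectors are dependent, by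
-- Gaussian elimination.

module Submission where

open import Defs
open import Data.Nat using (ℕ; zero; suc; _+_; _≤_; z≤n; s≤s)
import Data.Nat.Properties as ℕ
open import Data.Fin using (Fin; splitAt; join; punchIn; punchOut; _↑ˡ_; _↑ʳ_)
  renaming (zero to fzero; suc to fsuc)
import Data.Fin.Properties as Fin
open import Data.Rational using (ℚ; 0ℚ; 1ℚ; -_; 1/_; _-_; NonZero; ≢-nonZero)
  renaming (_+_ to _+ℚ_; _*_ to _*ℚ_)
import Data.Rational.Properties as ℚ
open import Data.Rational.Solver using (module +-*-Solver)
open import Algebra.Bundles using (CommutativeRing)
open import Algebra.Properties.Semiring.Sum (CommutativeRing.semiring ℚ.+-*-commutativeRing)
  using (sum; sum-cong-≗; ∑-distrib-+; ∑-comm; *-distribˡ-sum; *-distribʳ-sum)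
import Data.Vec.Functional as V
open import Data.Vec.Functional.Properties using (lookup-++ˡ; lookup-++ʳ)
open import Data.Sum using (_⊎_; inj₁; inj₂; [_,_]′)
open import Data.Sum.Properties using ([,]-map)
open import Data.Product using (Σ; ∃; _×_; _,_; proj₁; proj₂)
open import Data.Unit using (⊤; tt)
open import Data.Bool using (true; false)
open import Data.Bool.Properties using (T-≡; ¬-not)
open import Data.List using (List; []; _∷_; _++_)
open import Data.List.Properties using (length-tabulate)
open import Data.List.Membership.Propositional using (_∈_; _∉_)
open import Data.List.Membership.Propositional.Properties using (∈-++⁺ˡ; ∈-++⁺ʳ; ∈-++⁻; ∈-allFin)
open import Data.List.Relation.Unary.Any as Any using (here; there)
open import Data.List.Relation.Unary.Any.Properties using (any⁺; any⁻)
import Data.List.Relation.Unary.All as All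
import Data.List.Relation.Unary.All.Properties as All
open import Data.List.Relation.Unary.AllPairs using ([]; _∷_)
open import Data.List.Relation.Unary.Unique.Propositional using (Unique)
open import Data.List.Relation.Unary.Unique.Propositional.Properties using (allFin⁺; drop⁺; Unique[x∷xs]⇒x∉xs)
open import Data.List.Relation.Binary.Permutation.Propositional using (_↭_; ↭-sym; ↭⇒↭ₛ)
open import Data.List.Relation.Binary.Permutation.Propositional.Properties using (∈-resp-↭; ↭-length)
import Data.List.Relation.Binary.Permutation.Setoid.Properties as PermutationSetoid
open import Function using (id; _∘_; flip; Equivalence)
open import Function.Definitions using (Injective; Bijective)
open import Function.Bundles using (Bijection)
open import Function.Properties.Inverse using (↔⇒⤖; ↔-sym)
open import Effect.Monad using (RawMonad)
open import Level using (0ℓ)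
open import Relation.Binary.PropositionalEquality
open import Relation.Nullary using (¬_; ¬?; Dec; yes; no)
open import Relation.Nullary.Negation using (¬¬-Monad; ¬¬-map; contradiction)
open import Relation.Nullary.Decidable using (decidable-stable; ¬¬-excluded-middle; fromWitness; toWitness)

open RawMonad (¬¬-Monad {a = 0ℓ}) using (_>>=_; return)
open ≡-Reasoning

∑≡sum : ∀ r (f : Fin r → ℚ) → ∑ r f ≡ sum f
∑≡sum zero    f = refl
∑≡sum (suc r) f = cong (f fzero +ℚ_) (∑≡sum r (f ∘ fsuc))

∑-cong : ∀ r {f g : Fin r → ℚ} → (∀ i → f i ≡ g i) → ∑ r f ≡ ∑ r g
∑-cong r {f} {g} f≗g rewrite ∑≡sum r f | ∑≡sum r g = sum-cong-≗ f≗g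

∑≡0 : ∀ r {f : Fin r → ℚ} → (∀ i → f i ≡ 0ℚ) → ∑ r f ≡ 0ℚ
∑≡0 zero    f≗0 = refl
∑≡0 (suc r) f≗0 = cong₂ _+ℚ_ (f≗0 fzero) (∑≡0 r (f≗0 ∘ fsuc))

∑-+ : ∀ r (f g : Fin r → ℚ) → ∑ r (λ i → f i +ℚ g i) ≡ ∑ r f +ℚ ∑ r g
∑-+ r f g rewrite ∑≡sum r (λ i → f i +ℚ g i) | ∑≡sum r f | ∑≡sum r g = ∑-distrib-+ f g

*-distribˡ-∑ : ∀ r x (f : Fin r → ℚ) → x *ℚ ∑ r f ≡ ∑ r (λ i → x *ℚ f i)
*-distribˡ-∑ r x f rewrite ∑≡sum r f | ∑≡sum r (λ i → x *ℚ f i) = *-distribˡ-sum x f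

*-distribʳ-∑ : ∀ r x (f : Fin r → ℚ) → ∑ r f *ℚ x ≡ ∑ r (λ i → f i *ℚ x)
*-distribʳ-∑ r x f rewrite ∑≡sum r f | ∑≡sum r (λ i → f i *ℚ x) = *-distribʳ-sum x f

∑∑≡sum-sum : ∀ r m (f : Fin r → Fin m → ℚ) → ∑ r (λ i → ∑ m (f i)) ≡ sum (λ i → sum (f i))
∑∑≡sum-sum r m f = trans (∑≡sum r _) (sum-cong-≗ (λ i → ∑≡sum m (f i)))

∑-swap : ∀ r m (f : Fin r → Fin m → ℚ) → ∑ r (λ i → ∑ m (f i)) ≡ ∑ m (λ s → ∑ r (λ i → f i s))
∑-swap r m f = trans (∑∑≡sum-sum r m f) (trans (∑-comm f) (sym (∑∑≡sum-sum m r (flip f))))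

∑-++ : ∀ m p (f : Fin m → ℚ) (g : Fin p → ℚ) → ∑ (m + p) (f V.++ g) ≡ ∑ m f +ℚ ∑ p g
∑-++ zero    p f g = sym (ℚ.+-identityˡ _)
∑-++ (suc m) p f g = begin
  f fzero +ℚ ∑ (m + p) (λ s → (f V.++ g) (fsuc s))
    ≡⟨ cong (f fzero +ℚ_) (∑-cong (m + p) (λ s → [,]-map (splitAt m s))) ⟩
  f fzero +ℚ ∑ (m + p) (V.tail f V.++ g)
    ≡⟨ cong (f fzero +ℚ_) (∑-++ m p (V.tail f) g) ⟩
  f fzero +ℚ (∑ m (V.tail f) +ℚ ∑ p g)
    ≡⟨ ℚ.+-assoc (f fzero) _ _ ⟨
  ∑ (suc m) f +ℚ ∑ p g ∎

∑-++-* : ∀ m p (a c : Fin m → ℚ) (b d : Fin p → ℚ) →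
  ∑ (m + p) (λ s → (a V.++ b) s *ℚ (c V.++ d) s) ≡ ∑ m (λ s → a s *ℚ c s) +ℚ ∑ p (λ s → b s *ℚ d s)
∑-++-* m p a c b d =
  trans (∑-cong (m + p) (λ s → blockwise (splitAt m s))) (∑-++ m p _ _)
  where
  blockwise : ∀ q → [ a , b ]′ q *ℚ [ c , d ]′ q ≡ [ (λ s → a s *ℚ c s) , (λ s → b s *ℚ d s) ]′ q
  blockwise (inj₁ _) = refl
  blockwise (inj₂ _) = refl

InSpan : ∀ {m N} → (Fin N → ℚ) → (Fin m → Fin N → ℚ) → Set
InSpan {m} x u = Σ (Fin m → ℚ) λ β → ∀ j → x j ≡ ∑ m (λ s → β s *ℚ u s j)

SpannedBy : ∀ {r N} → (Fin r → Fin N → ℚ) → ℕ → Set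
SpannedBy {N = N} v m = Σ (Fin m → Fin N → ℚ) λ u → ∀ i → InSpan (v i) u

NontrivialRelation : ∀ {r N} → (Fin r → Fin N → ℚ) → Set
NontrivialRelation {r} v =
  Σ (Fin r → ℚ) λ c → (∃ λ i → c i ≢ 0ℚ) × (∀ j → ∑ r (λ i → c i *ℚ v i j) ≡ 0ℚ)

independent⇒¬relation : ∀ {r N} {v : Fin r → Fin N → ℚ} →
  LinearlyIndependent v → ¬ NontrivialRelation v
independent⇒¬relation independent (c , (i , cᵢ≢0) , relation) = cᵢ≢0 (independent c relation i)

InSpan-here : ∀ {m N} (x : Fin N → ℚ) (u : Fin m → Fin N → ℚ) → InSpan x (x V.∷ u)
InSpan-here {m} x u = (1ℚ V.∷ λ _ → 0ℚ) , λ j → sym (begin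
  1ℚ *ℚ x j +ℚ ∑ m (λ s → 0ℚ *ℚ u s j) ≡⟨ cong₂ _+ℚ_ (ℚ.*-identityˡ (x j)) (∑≡0 m (λ s → ℚ.*-zeroˡ (u s j))) ⟩
  x j +ℚ 0ℚ                             ≡⟨ ℚ.+-identityʳ (x j) ⟩
  x j                                   ∎)

InSpan-there : ∀ {m N} {x y : Fin N → ℚ} {u : Fin m → Fin N → ℚ} → InSpan x u → InSpan x (y V.∷ u)
InSpan-there {m} {y = y} {u} (β , x≡βu) = (0ℚ V.∷ β) , λ j →
  trans (x≡βu j) (sym (trans (cong (_+ℚ ∑ m (λ s → β s *ℚ u s j)) (ℚ.*-zeroˡ (y j))) (ℚ.+-identityˡ _)))

relation-of-zero-head : ∀ {r N} (v : Fin (suc r) → Fin N → ℚ) → (∀ j → v fzero j ≡ 0ℚ) →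
  NontrivialRelation v
relation-of-zero-head {r} v v₀≡0 = (1ℚ V.∷ λ _ → 0ℚ) , (fzero , λ ()) , λ j →
  cong₂ _+ℚ_ (trans (ℚ.*-identityˡ _) (v₀≡0 j)) (∑≡0 r (λ i → ℚ.*-zeroˡ (v (fsuc i) j)))

-- One step of Gaussian elimination: clear column q with the pivot M₀q.
module Pivot {r m} (M : Fin (suc r) → Fin (suc m) → ℚ) (q : Fin (suc m)) (p≢0 : M fzero q ≢ 0ℚ) where
  open +-*-Solver

  p : ℚ
  p = M fzero q

  instance
    p-nonZero : NonZero p
    p-nonZero = ≢-nonZero p≢0

  eliminated : Fin r → Fin m → ℚ
  eliminated i s = M (fsuc i) (punchIn q s) - (M (fsuc i) q *ℚ 1/ p) *ℚ M fzero (punchIn q s)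

  lift-relation : NontrivialRelation eliminated → NontrivialRelation M
  lift-relation (c , (i , cᵢ≢0) , relation) = (- (S *ℚ 1/ p) V.∷ c) , (fsuc i , cᵢ≢0) , relation′
    where
    S : ℚ
    S = ∑ r (λ i → c i *ℚ M (fsuc i) q)

    relation-at-pivot : - (S *ℚ 1/ p) *ℚ p +ℚ S ≡ 0ℚ
    relation-at-pivot = begin
      - (S *ℚ 1/ p) *ℚ p +ℚ S   ≡⟨ solve 3 (λ S ip p → (:- (S :* ip)) :* p :+ S := S :- S :* (ip :* p)) refl S (1/ p) p ⟩
      S - S *ℚ (1/ p *ℚ p)      ≡⟨ cong (λ x → S - S *ℚ x) (ℚ.*-inverseˡ p) ⟩
      S - S *ℚ 1ℚ               ≡⟨ solve 1 (λ S → S :- S :* con 1ℚ := con 0ℚ) refl S ⟩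
      0ℚ                        ∎

    relation-off-pivot : ∀ s → - (S *ℚ 1/ p) *ℚ M fzero (punchIn q s) +ℚ ∑ r (λ i → c i *ℚ M (fsuc i) (punchIn q s)) ≡ 0ℚ
    relation-off-pivot s = begin
      a +ℚ ∑ r (λ i → c i *ℚ M (fsuc i) u)
        ≡⟨ cong (a +ℚ_) (∑-cong r unfold-elimination) ⟩
      a +ℚ ∑ r (λ i → c i *ℚ eliminated i s +ℚ (1/ p *ℚ x) *ℚ (c i *ℚ M (fsuc i) q))
        ≡⟨ cong (a +ℚ_) (∑-+ r _ _) ⟩
      a +ℚ (∑ r (λ i → c i *ℚ eliminated i s) +ℚ ∑ r (λ i → (1/ p *ℚ x) *ℚ (c i *ℚ M (fsuc i) q)))
        ≡⟨ cong₂ (λ y z → a +ℚ (y +ℚ z)) (relation s) (sym (*-distribˡ-∑ r (1/ p *ℚ x) _)) ⟩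
      a +ℚ (0ℚ +ℚ (1/ p *ℚ x) *ℚ S)
        ≡⟨ solve 3 (λ S ip x → (:- (S :* ip)) :* x :+ (con 0ℚ :+ (ip :* x) :* S) := con 0ℚ) refl S (1/ p) x ⟩
      0ℚ ∎
      where
      u : Fin (suc m)
      u = punchIn q s
      x a : ℚ
      x = M fzero u
      a = - (S *ℚ 1/ p) *ℚ x
      unfold-elimination : ∀ i → c i *ℚ M (fsuc i) u ≡ c i *ℚ eliminated i s +ℚ (1/ p *ℚ x) *ℚ (c i *ℚ M (fsuc i) q)
      unfold-elimination i = solve 5 (λ c y z ip x → c :* y := c :* (y :- (z :* ip) :* x) :+ (ip :* x) :* (c :* z))
        refl (c i) (M (fsuc i) u) (M (fsuc i) q) (1/ p) x

    relation′ : ∀ t → ∑ (suc r) (λ i → (- (S *ℚ 1/ p) V.∷ c) i *ℚ M i t) ≡ 0ℚ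
    relation′ t with t Fin.≟ q
    ... | yes refl = relation-at-pivot
    ... | no t≢q = subst (λ t → - (S *ℚ 1/ p) *ℚ M fzero t +ℚ ∑ r (λ i → c i *ℚ M (fsuc i) t) ≡ 0ℚ)
                     (Fin.punchIn-punchOut (t≢q ∘ sym)) (relation-off-pivot (punchOut (t≢q ∘ sym)))

relation-in-lower-dimension : ∀ {r m} → m ≤ r → (M : Fin (suc r) → Fin m → ℚ) → NontrivialRelation M
relation-in-lower-dimension {r} {zero} _ M = (λ _ → 1ℚ) , (fzero , λ ()) , λ ()
relation-in-lower-dimension {suc r} {suc m} (s≤s m≤r) M with Fin.any? (λ q → ¬? (M fzero q ℚ.≟ 0ℚ))
... | yes (q , p≢0) = Pivot.lift-relation M q p≢0 (relation-in-lower-dimension m≤r (Pivot.eliminated M q p≢0))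
... | no ∄pivot = relation-of-zero-head M (λ j → decidable-stable (M fzero j ℚ.≟ 0ℚ) (λ M₀ⱼ≢0 → ∄pivot (j , M₀ⱼ≢0)))

relation-of-combinations : ∀ {R m N} (y : Fin R → Fin N → ℚ) (z : Fin m → Fin N → ℚ) (M : Fin R → Fin m → ℚ) →
  (∀ i j → y i j ≡ ∑ m (λ s → M i s *ℚ z s j)) →
  (c : Fin R → ℚ) → (∀ s → ∑ R (λ i → c i *ℚ M i s) ≡ 0ℚ) → ∀ j → ∑ R (λ i → c i *ℚ y i j) ≡ 0ℚ
relation-of-combinations {R} {m} y z M y≡Mz c relation j = begin
  ∑ R (λ i → c i *ℚ y i j)                          ≡⟨ ∑-cong R (λ i → cong (c i *ℚ_) (y≡Mz i j)) ⟩
  ∑ R (λ i → c i *ℚ ∑ m (λ s → M i s *ℚ z s j))     ≡⟨ ∑-cong R (λ i → *-distribˡ-∑ m (c i) _) ⟩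
  ∑ R (λ i → ∑ m (λ s → c i *ℚ (M i s *ℚ z s j)))   ≡⟨ ∑-swap R m _ ⟩
  ∑ m (λ s → ∑ R (λ i → c i *ℚ (M i s *ℚ z s j)))   ≡⟨ ∑-cong m (λ s → ∑-cong R (λ i → sym (ℚ.*-assoc (c i) _ _))) ⟩
  ∑ m (λ s → ∑ R (λ i → (c i *ℚ M i s) *ℚ z s j))   ≡⟨ ∑-cong m (λ s → sym (*-distribʳ-∑ R (z s j) _)) ⟩
  ∑ m (λ s → ∑ R (λ i → c i *ℚ M i s) *ℚ z s j)     ≡⟨ ∑≡0 m (λ s → trans (cong (_*ℚ z s j) (relation s)) (ℚ.*-zeroˡ (z s j))) ⟩
  0ℚ ∎

relation-in-span : ∀ {R m N} → m ≤ R → (y : Fin (suc R) → Fin N → ℚ) (z : Fin m → Fin N → ℚ) →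
  (∀ i → InSpan (y i) z) → NontrivialRelation y
relation-in-span m≤R y z y∈span =
  let c , nontrivial , relation = relation-in-lower-dimension m≤R (proj₁ ∘ y∈span)
  in c , nontrivial , relation-of-combinations y z (proj₁ ∘ y∈span) (proj₂ ∘ y∈span) c relation

independent-∷ : ∀ {m N} (w : Fin (suc m) → Fin N → ℚ) →
  LinearlyIndependent (V.tail w) → ¬ InSpan (V.head w) (V.tail w) → LinearlyIndependent w
independent-∷ {m} w tail-independent head∉span c relation = coefficients≡0
  where
  T : Fin _ → ℚ
  T j = ∑ m (λ s → c (fsuc s) *ℚ w (fsuc s) j)

  head∈span : c fzero ≢ 0ℚ → InSpan (V.head w) (V.tail w)
  head∈span c₀≢0 = (λ s → (- 1/ c₀) *ℚ c (fsuc s)) , λ j → begin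
    w fzero j                                        ≡⟨ ℚ.*-identityˡ _ ⟨
    1ℚ *ℚ w fzero j                                  ≡⟨ cong (_*ℚ w fzero j) (ℚ.*-inverseˡ c₀) ⟨
    (1/ c₀ *ℚ c₀) *ℚ w fzero j                       ≡⟨ solve 4 (λ ic c x t → (ic :* c) :* x := ic :* (c :* x :+ t) :+ (:- ic) :* t) refl (1/ c₀) c₀ (w fzero j) (T j) ⟩
    1/ c₀ *ℚ (c₀ *ℚ w fzero j +ℚ T j) +ℚ (- 1/ c₀) *ℚ T j  ≡⟨ cong (λ x → 1/ c₀ *ℚ x +ℚ (- 1/ c₀) *ℚ T j) (relation j) ⟩
    1/ c₀ *ℚ 0ℚ +ℚ (- 1/ c₀) *ℚ T j                  ≡⟨ solve 2 (λ ic t → ic :* con 0ℚ :+ (:- ic) :* t := (:- ic) :* t) refl (1/ c₀) (T j) ⟩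
    (- 1/ c₀) *ℚ T j                                 ≡⟨ *-distribˡ-∑ m (- 1/ c₀) _ ⟩
    ∑ m (λ s → (- 1/ c₀) *ℚ (c (fsuc s) *ℚ w (fsuc s) j)) ≡⟨ ∑-cong m (λ s → sym (ℚ.*-assoc (- 1/ c₀) _ _)) ⟩
    ∑ m (λ s → ((- 1/ c₀) *ℚ c (fsuc s)) *ℚ w (fsuc s) j) ∎
    where
    open +-*-Solver
    c₀ : ℚ
    c₀ = c fzero
    instance
      c₀-nonZero : NonZero c₀
      c₀-nonZero = ≢-nonZero c₀≢0

  c₀≡0 : c fzero ≡ 0ℚ
  c₀≡0 = decidable-stable (c fzero ℚ.≟ 0ℚ) (head∉span ∘ head∈span)

  T≡0 : ∀ j → T j ≡ 0ℚ
  T≡0 j = begin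
    T j                         ≡⟨ ℚ.+-identityˡ (T j) ⟨
    0ℚ +ℚ T j                   ≡⟨ cong (_+ℚ T j) (ℚ.*-zeroˡ (w fzero j)) ⟨
    0ℚ *ℚ w fzero j +ℚ T j      ≡⟨ cong (λ x → x *ℚ w fzero j +ℚ T j) c₀≡0 ⟨
    c fzero *ℚ w fzero j +ℚ T j ≡⟨ relation j ⟩
    0ℚ                          ∎

  coefficients≡0 : ∀ i → c i ≡ 0ℚ
  coefficients≡0 fzero    = c₀≡0
  coefficients≡0 (fsuc i) = tail-independent (V.tail c) T≡0 i

record SubfamilyBasis {r N} (v : Fin r → Fin N → ℚ) (m : ℕ) : Set where
  field
    index           : Fin m → Fin r
    index-injective : Injective _≡_ _≡_ index
    independent     : LinearlyIndependent (v ∘ index)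
    spans           : ∀ i → InSpan (v i) (v ∘ index)

zero∷suc-injective : ∀ {m r} {g : Fin m → Fin r} → Injective _≡_ _≡_ g →
  Injective _≡_ _≡_ (fzero V.∷ fsuc ∘ g)
zero∷suc-injective g-injective {fzero}  {fzero}  _  = refl
zero∷suc-injective g-injective {fzero}  {fsuc _} ()
zero∷suc-injective g-injective {fsuc _} {fzero}  ()
zero∷suc-injective g-injective {fsuc _} {fsuc _} eq = cong fsuc (g-injective (Fin.suc-injective eq))

module _ {r N m} {v : Fin (suc r) → Fin N → ℚ} (basis : SubfamilyBasis (V.tail v) m) where
  open SubfamilyBasis basis

  SubfamilyBasis-∷-inSpan : InSpan (v fzero) (V.tail v ∘ index) → SubfamilyBasis v m
  SubfamilyBasis-∷-inSpan head∈span = record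
    { index           = fsuc ∘ index
    ; index-injective = index-injective ∘ Fin.suc-injective
    ; independent     = independent
    ; spans           = λ { fzero → head∈span ; (fsuc i) → spans i }
    }

  SubfamilyBasis-∷-notInSpan : ¬ InSpan (v fzero) (V.tail v ∘ index) → SubfamilyBasis v (suc m)
  SubfamilyBasis-∷-notInSpan head∉span = record
    { index           = fzero V.∷ fsuc ∘ index
    ; index-injective = zero∷suc-injective index-injective
    ; independent     = independent-∷ (v ∘ (fzero V.∷ fsuc ∘ index)) independent head∉span
    ; spans           = λ { fzero → InSpan-here _ _ ; (fsuc i) → InSpan-there (spans i) }
    }

-- A greedy scan from the last vector. Membership in the span is decided by
-- excluded middle, hence the ¬ ¬, which is harmless as RankAtMost is a negation.
¬¬SubfamilyBasis : ∀ {r N} a (v : Fin r → Fin N → ℚ) →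
  (∀ (h : Fin (suc a) → Fin r) → Injective _≡_ _≡_ h → ¬ LinearlyIndependent (v ∘ h)) →
  ¬ ¬ (∃ λ m → m ≤ a × SubfamilyBasis v m)
¬¬SubfamilyBasis {zero} a v _ = return (0 , z≤n , record
  { index = λ () ; index-injective = λ { {()} } ; independent = λ _ _ () ; spans = λ () })
¬¬SubfamilyBasis {suc r} a v no-independent = do
  m , m≤a , basis ← ¬¬SubfamilyBasis a (V.tail v) λ h h-injective →
                      no-independent (fsuc ∘ h) (h-injective ∘ Fin.suc-injective)
  head∈span? ← ¬¬-excluded-middle
  extend m≤a basis head∈span?
  where
  extend : ∀ {m} → m ≤ a → (basis : SubfamilyBasis (V.tail v) m) →
    Dec (InSpan (v fzero) (V.tail v ∘ SubfamilyBasis.index basis)) → ¬ ¬ (∃ λ m → m ≤ a × SubfamilyBasis v m)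
  extend m≤a basis (yes head∈span) = return (_ , m≤a , SubfamilyBasis-∷-inSpan {v = v} basis head∈span)
  extend m≤a basis (no head∉span) with ℕ.m≤n⇒m<n∨m≡n m≤a
  ... | inj₁ m<a  = return (_ , m<a , SubfamilyBasis-∷-notInSpan {v = v} basis head∉span)
  ... | inj₂ refl = λ _ → no-independent index index-injective independent
    where open SubfamilyBasis (SubfamilyBasis-∷-notInSpan {v = v} basis head∉span)

asℚ : ∀ {m n} → Mat m n → Fin m → Fin n → ℚ
asℚ X i j = toℚ (X i j)

spanned⇒RankAtMost : ∀ {k N m a} (X : Mat k N) → m ≤ a → SpannedBy (asℚ X) m → RankAtMost X a
spanned⇒RankAtMost X m≤a (u , rows∈span) f _ independent =
  independent⇒¬relation {v = asℚ X ∘ f} independent (relation-in-span m≤a (asℚ X ∘ f) u (rows∈span ∘ f))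

RankAtMost⇒¬¬spanned : ∀ {k N a} (X : Mat k N) → RankAtMost X a →
  ¬ ¬ (∃ λ m → m ≤ a × SpannedBy (asℚ X) m)
RankAtMost⇒¬¬spanned {a = a} X rank≤a =
  ¬¬-map (λ (m , m≤a , basis) → m , m≤a , (asℚ X ∘ SubfamilyBasis.index basis) , SubfamilyBasis.spans basis)
         (¬¬SubfamilyBasis a (asℚ X) rank≤a)

RankAtMost-zero : ∀ {k N} (X : Mat k N) → RankAtMost X 0 → ∀ i j → asℚ X i j ≡ 0ℚ
RankAtMost-zero X rank≤0 i j = decidable-stable (asℚ X i j ℚ.≟ 0ℚ)
  (¬¬-map (λ { (.0 , z≤n , _ , rows∈span) → proj₂ (rows∈span i) j }) (RankAtMost⇒¬¬spanned X rank≤0))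

RankAtMost-row : ∀ {N} r (X : Mat 1 N) → (r ≡ 0 → ∀ j → asℚ X fzero j ≡ 0ℚ) → RankAtMost X r
RankAtMost-row zero    X row≡0 = spanned⇒RankAtMost X z≤n ((λ ()) , λ { fzero → (λ ()) , row≡0 refl })
RankAtMost-row (suc r) X _     =
  spanned⇒RankAtMost X (s≤s z≤n) ((asℚ X fzero V.∷ nothing) , λ { fzero → InSpan-here (asℚ X fzero) nothing })
  where
  nothing : Fin 0 → Fin _ → ℚ
  nothing ()

spanned-∣∣ : ∀ {k n p m₁ m₂} (A : Mat k n) (C : Mat k p) →
  SpannedBy (asℚ A) m₁ → SpannedBy (asℚ C) m₂ → SpannedBy (asℚ (A ∣∣ C)) (m₁ + m₂)
spanned-∣∣ {n = n} {p} {m₁} {m₂} A C (u , A∈span) (u′ , C∈span) =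
  (λ s j → padded s (splitAt n j)) , λ i → (proj₁ (A∈span i) V.++ proj₁ (C∈span i)) , λ j → entry i (splitAt n j)
  where
  padded : Fin (m₁ + m₂) → Fin n ⊎ Fin p → ℚ
  padded s (inj₁ j) = ((λ s₁ → u s₁ j) V.++ (λ _ → 0ℚ)) s
  padded s (inj₂ j) = ((λ _ → 0ℚ) V.++ (λ s₂ → u′ s₂ j)) s

  entry : ∀ i q → toℚ ([ A i , C i ]′ q) ≡
    ∑ (m₁ + m₂) (λ s → (proj₁ (A∈span i) V.++ proj₁ (C∈span i)) s *ℚ padded s q)
  entry i (inj₁ j) = sym (begin
    ∑ (m₁ + m₂) (λ s → (β V.++ γ) s *ℚ padded s (inj₁ j))   ≡⟨ ∑-++-* m₁ m₂ β (λ s → u s j) γ (λ _ → 0ℚ) ⟩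
    ∑ m₁ (λ s → β s *ℚ u s j) +ℚ ∑ m₂ (λ s → γ s *ℚ 0ℚ)    ≡⟨ cong (∑ m₁ (λ s → β s *ℚ u s j) +ℚ_) (∑≡0 m₂ (ℚ.*-zeroʳ ∘ γ)) ⟩
    ∑ m₁ (λ s → β s *ℚ u s j) +ℚ 0ℚ                         ≡⟨ ℚ.+-identityʳ _ ⟩
    ∑ m₁ (λ s → β s *ℚ u s j)                               ≡⟨ proj₂ (A∈span i) j ⟨
    toℚ (A i j)                                             ∎)
    where
    β : Fin m₁ → ℚ
    β = proj₁ (A∈span i)
    γ : Fin m₂ → ℚ
    γ = proj₁ (C∈span i)
  entry i (inj₂ j) = sym (begin
    ∑ (m₁ + m₂) (λ s → (β V.++ γ) s *ℚ padded s (inj₂ j))   ≡⟨ ∑-++-* m₁ m₂ β (λ _ → 0ℚ) γ (λ s → u′ s j) ⟩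
    ∑ m₁ (λ s → β s *ℚ 0ℚ) +ℚ ∑ m₂ (λ s → γ s *ℚ u′ s j)   ≡⟨ cong (_+ℚ ∑ m₂ (λ s → γ s *ℚ u′ s j)) (∑≡0 m₁ (ℚ.*-zeroʳ ∘ β)) ⟩
    0ℚ +ℚ ∑ m₂ (λ s → γ s *ℚ u′ s j)                        ≡⟨ ℚ.+-identityˡ _ ⟩
    ∑ m₂ (λ s → γ s *ℚ u′ s j)                              ≡⟨ proj₂ (C∈span i) j ⟨
    toℚ (C i j)                                             ∎)
    where
    β : Fin m₁ → ℚ
    β = proj₁ (A∈span i)
    γ : Fin m₂ → ℚ
    γ = proj₁ (C∈span i)

RankAtMost-∣∣ : ∀ {k n p a b} (A : Mat k n) (C : Mat k p) →
  RankAtMost A a → RankAtMost C b → RankAtMost (A ∣∣ C) (a + b)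
RankAtMost-∣∣ A C rank-A rank-C f f-injective independent =
  RankAtMost⇒¬¬spanned A rank-A λ (m₁ , m₁≤a , A-spanned) →
  RankAtMost⇒¬¬spanned C rank-C λ (m₂ , m₂≤b , C-spanned) →
  spanned⇒RankAtMost (A ∣∣ C) (ℕ.+-mono-≤ m₁≤a m₂≤b) (spanned-∣∣ A C A-spanned C-spanned) f f-injective independent

RankAtMost-mono : ∀ {k N a b} (X : Mat k N) → a ≤ b → RankAtMost X a → RankAtMost X b
RankAtMost-mono X a≤b rank≤a f f-injective independent =
  RankAtMost⇒¬¬spanned X rank≤a λ (m , m≤a , spanned) →
  spanned⇒RankAtMost X (ℕ.≤-trans m≤a a≤b) spanned f f-injective independent

RankAtMost-reindex : ∀ {m n m′ n′ r} (X : Mat m n) (Y : Mat m′ n′) (ι : Fin m → Fin m′) (κ : Fin n → Fin n′) →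
  Injective _≡_ _≡_ ι → (∀ i j → X i j ≡ Y (ι i) (κ j)) → RankAtMost Y r → RankAtMost X r
RankAtMost-reindex {r = r} X Y ι κ ι-injective X≡Y rank-Y f f-injective independent =
  rank-Y (ι ∘ f) (f-injective ∘ ι-injective) λ c relation →
    independent c (λ j → trans (∑-cong (suc r) (λ i → cong (λ x → c i *ℚ toℚ x) (X≡Y (f i) j))) (relation (κ j)))

Fin1-irrelevant : (i j : Fin 1) → i ≡ j
Fin1-irrelevant fzero fzero = refl

module _ {k : ℕ} where

  Unique-++⁻ˡ : ∀ (xs : List (Fin k)) {ys} → Unique (xs ++ ys) → Unique xs
  Unique-++⁻ˡ []       _                = []
  Unique-++⁻ˡ (x ∷ xs) (x∉xs++ys ∷ uq) = All.++⁻ˡ xs x∉xs++ys ∷ Unique-++⁻ˡ xs uq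

  Unique-++⁻ʳ : ∀ (xs : List (Fin k)) {ys} → Unique (xs ++ ys) → Unique ys
  Unique-++⁻ʳ []       uq       = uq
  Unique-++⁻ʳ (x ∷ xs) (_ ∷ uq) = Unique-++⁻ʳ xs uq

  Unique-++⇒disjoint : ∀ (xs : List (Fin k)) {ys y} → Unique (xs ++ ys) → y ∈ ys → y ∉ xs
  Unique-++⇒disjoint (x ∷ xs) (x∉ ∷ _)  y∈ys (here refl) = All.lookup x∉ (∈-++⁺ʳ xs y∈ys) refl
  Unique-++⇒disjoint (x ∷ xs) (_ ∷ uq)  y∈ys (there y∈xs) = Unique-++⇒disjoint xs uq y∈ys y∈xs

  Unique-resp-↭ : ∀ {xs ys : List (Fin k)} → xs ↭ ys → Unique xs → Unique ys
  Unique-resp-↭ xs↭ys = PermutationSetoid.Unique-resp-↭ (setoid (Fin k)) (↭⇒↭ₛ xs↭ys)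

  ∈⇒∈ᵇ : ∀ {x : Fin k} {xs} → x ∈ xs → (x ∈ᵇ xs) ≡ true
  ∈⇒∈ᵇ x∈xs = Equivalence.to T-≡ (any⁺ _ (Any.map (λ x≡y → fromWitness (sym x≡y)) x∈xs))

  ∉⇒∉ᵇ : ∀ {x : Fin k} {xs} → x ∉ xs → (x ∈ᵇ xs) ≡ false
  ∉⇒∉ᵇ x∉xs = ¬-not λ x∈ᵇxs →
    x∉xs (Any.map (λ y≟x → sym (toWitness y≟x)) (any⁻ _ _ (Equivalence.from T-≡ x∈ᵇxs)))

  cutMatrix-across : ∀ (G : Mat k k) {S x y} → x ∈ S → y ∉ S → cutMatrix G S x y ≡ edges G x y
  cutMatrix-across G x∈S y∉S rewrite ∈⇒∈ᵇ x∈S | ∉⇒∉ᵇ y∉S = refl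

  ⊑-trans : ∀ {s s′ t : STree k} → s ⊑ s′ → s′ ⊑ t → s ⊑ t
  ⊑-trans s⊑s′ here        = s⊑s′
  ⊑-trans s⊑s′ (in1 s′⊑t)  = in1 (⊑-trans s⊑s′ s′⊑t)
  ⊑-trans s⊑s′ (in2ˡ s′⊑t) = in2ˡ (⊑-trans s⊑s′ s′⊑t)
  ⊑-trans s⊑s′ (in2ʳ s′⊑t) = in2ʳ (⊑-trans s⊑s′ s′⊑t)

  #leaves : STree k → ℕ
  #leaves (leaf _)    = 1
  #leaves (node1 s)   = #leaves s
  #leaves (node2 a b) = #leaves a + #leaves b

  leafAt : (s : STree k) → Fin (#leaves s) → Fin k
  leafAt (leaf x)    _ = x
  leafAt (node1 s)     = leafAt s
  leafAt (node2 a b)   = leafAt a V.++ leafAt b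

  leafAt-∈ : ∀ s i → leafAt s i ∈ leavesS s
  leafAt-∈ (leaf x)    _ = here refl
  leafAt-∈ (node1 s)   i = leafAt-∈ s i
  leafAt-∈ (node2 a b) i = ∈-++ (splitAt (#leaves a) i)
    where
    ∈-++ : ∀ q → [ leafAt a , leafAt b ]′ q ∈ leavesS a ++ leavesS b
    ∈-++ (inj₁ i) = ∈-++⁺ˡ (leafAt-∈ a i)
    ∈-++ (inj₂ i) = ∈-++⁺ʳ (leavesS a) (leafAt-∈ b i)

  ∈⇒leafAt : ∀ s {x} → x ∈ leavesS s → ∃ λ i → leafAt s i ≡ x
  ∈⇒leafAt (leaf x)    (here refl) = fzero , refl
  ∈⇒leafAt (node1 s)   x∈s         = ∈⇒leafAt s x∈s
  ∈⇒leafAt (node2 a b) x∈s with ∈-++⁻ (leavesS a) x∈s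
  ... | inj₁ x∈a = let i , eq = ∈⇒leafAt a x∈a in i ↑ˡ #leaves b , trans (lookup-++ˡ (leafAt a) (leafAt b) i) eq
  ... | inj₂ x∈b = let i , eq = ∈⇒leafAt b x∈b in #leaves a ↑ʳ i , trans (lookup-++ʳ (leafAt a) (leafAt b) i) eq

  leafAt-injective : ∀ s → Unique (leavesS s) → Injective _≡_ _≡_ (leafAt s)
  leafAt-injective (leaf _)    _  {i} {j} _ = Fin1-irrelevant i j
  leafAt-injective (node1 s)   uq           = leafAt-injective s uq
  leafAt-injective (node2 a b) uq {i} {j} eq = begin
    i                                   ≡⟨ Fin.join-splitAt (#leaves a) (#leaves b) i ⟨
    join _ _ (splitAt (#leaves a) i)    ≡⟨ cong (join _ _) (blockwise (splitAt (#leaves a) i) (splitAt (#leaves a) j) eq) ⟩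
    join _ _ (splitAt (#leaves a) j)    ≡⟨ Fin.join-splitAt (#leaves a) (#leaves b) j ⟩
    j                                   ∎
    where
    blockwise : ∀ q q′ → [ leafAt a , leafAt b ]′ q ≡ [ leafAt a , leafAt b ]′ q′ → q ≡ q′
    blockwise (inj₁ i) (inj₁ j) eq = cong inj₁ (leafAt-injective a (Unique-++⁻ˡ (leavesS a) uq) eq)
    blockwise (inj₁ i) (inj₂ j) eq =
      contradiction (subst (_∈ leavesS a) eq (leafAt-∈ a i)) (Unique-++⇒disjoint (leavesS a) uq (leafAt-∈ b j))
    blockwise (inj₂ i) (inj₁ j) eq =
      contradiction (subst (_∈ leavesS a) (sym eq) (leafAt-∈ a j)) (Unique-++⇒disjoint (leavesS a) uq (leafAt-∈ b i))
    blockwise (inj₂ i) (inj₂ j) eq = cong inj₂ (leafAt-injective b (Unique-++⁻ʳ (leavesS a) uq) eq)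

join-bijective : ∀ m n → Bijective _≡_ _≡_ (join m n)
join-bijective m n = Bijection.bijective (↔⇒⤖ (↔-sym (Fin.+↔⊎ {m} {n})))

module _ {k : ℕ} where

  enumerateRooted : Fin k → (t : STree k) → Fin 1 ⊎ Fin (#leaves t) → Fin k
  enumerateRooted v t = [ (λ _ → v) , leafAt t ]′

  enumerateRooted-bijective : ∀ {v t} → IsRankDecomposition (rooted v t) → Bijective _≡_ _≡_ (enumerateRooted v t)
  enumerateRooted-bijective {v} {t} perm = injective , surjective
    where
    uq : Unique (v ∷ leavesS t)
    uq = Unique-resp-↭ (↭-sym perm) (allFin⁺ k)

    injective : Injective _≡_ _≡_ (enumerateRooted v t)
    injective {inj₁ i} {inj₁ j} _  = cong inj₁ (Fin1-irrelevant i j)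
    injective {inj₁ _} {inj₂ j} eq = contradiction (subst (_∈ leavesS t) (sym eq) (leafAt-∈ t j)) (Unique[x∷xs]⇒x∉xs uq)
    injective {inj₂ i} {inj₁ _} eq = contradiction (subst (_∈ leavesS t) eq (leafAt-∈ t i)) (Unique[x∷xs]⇒x∉xs uq)
    injective {inj₂ i} {inj₂ j} eq = cong inj₂ (leafAt-injective t (drop⁺ 1 uq) eq)

    surjective : ∀ y → ∃ λ x → ∀ {z} → z ≡ x → enumerateRooted v t z ≡ y
    surjective y with ∈-resp-↭ (↭-sym perm) (∈-allFin y)
    ... | here y≡v  = inj₁ fzero , λ { refl → sym y≡v }
    ... | there y∈t = let i , eq = ∈⇒leafAt t y∈t in inj₂ i , λ { refl → eq }

edges-comm : ∀ {k} (G : Mat k k) x y → edges G x y ≡ edges G y x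
edges-comm G x y = ℕ.+-comm (G x y) (G y x)

module Construction {k n : ℕ} (G : Mat k k) (B : Mat k n) where

  fullBoundary : Fin k → Fin n ⊎ Fin k → ℕ
  fullBoundary x (inj₁ j) = B x j
  fullBoundary x (inj₂ y) = edges G x y

  Outside : List (Fin k) → Fin n ⊎ Fin k → Set
  Outside S (inj₁ _) = ⊤
  Outside S (inj₂ y) = y ∉ S

  Outside-++⁻ˡ : ∀ xs {ys} q → Outside (xs ++ ys) q → Outside xs q
  Outside-++⁻ˡ xs (inj₁ _) _     = tt
  Outside-++⁻ˡ xs (inj₂ _) y∉xys = y∉xys ∘ ∈-++⁺ˡ

  Outside-++⁻ʳ : ∀ xs {ys} q → Outside (xs ++ ys) q → Outside ys q
  Outside-++⁻ʳ xs (inj₁ _) _     = tt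
  Outside-++⁻ʳ xs (inj₂ _) y∉xys = y∉xys ∘ ∈-++⁺ʳ xs

  fullBoundary-cut : ∀ {S x} → x ∈ S → ∀ q → Outside S q →
    fullBoundary x q ≡ (B ∣∣ cutMatrix G S) x (join n k q)
  fullBoundary-cut {S} {x} x∈S q q-outside = trans (entry q q-outside)
    (cong [ B x , cutMatrix G S x ]′ (sym (Fin.splitAt-join n k q)))
    where
    entry : ∀ q → Outside S q → fullBoundary x q ≡ [ B x , cutMatrix G S x ]′ q
    entry (inj₁ _) _   = refl
    entry (inj₂ _) y∉S = sym (cutMatrix-across G x∈S y∉S)

  -- port j says what the j-th dangling edge of (G′ , B′) is in Γ: a dangling
  -- edge of Γ, or an edge of G to a vertex outside the leaves of s.
  record Induced (s : STree k) {n′} (G′ : Mat (#leaves s) (#leaves s)) (B′ : Mat (#leaves s) n′) : Set where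
    constructor induced
    field
      port      : Fin n′ → Fin n ⊎ Fin k
      graph≡    : ∀ i j → G′ i j ≡ G (leafAt s i) (leafAt s j)
      boundary≡ : ∀ i j → B′ i j ≡ fullBoundary (leafAt s i) (port j)
      outside   : ∀ j → Outside (leavesS s) (port j)

    edges≡ : ∀ i j → edges G′ i j ≡ edges G (leafAt s i) (leafAt s j)
    edges≡ i j = cong₂ _+_ (graph≡ i j) (graph≡ j i)

  Induced-rank : ∀ {s w ρ n′ G′} {B′ : Mat (#leaves s) n′} → Unique (leavesS s) →
    RankAtMost (cutMatrix G (leavesS s)) w → RankAtMost B ρ → Induced s G′ B′ → RankAtMost B′ (w + ρ)
  Induced-rank {s} {w} {ρ} {B′ = B′} uq rank-cut rank-B (induced port _ boundary≡ outside) =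
    RankAtMost-reindex B′ (B ∣∣ cutMatrix G (leavesS s)) (leafAt s) (join n k ∘ port) (leafAt-injective s uq)
      (λ i j → trans (boundary≡ i j) (fullBoundary-cut (leafAt-∈ s i) (port j) (outside j)))
      (subst (RankAtMost (B ∣∣ cutMatrix G (leavesS s))) (ℕ.+-comm ρ w) (RankAtMost-∣∣ B (cutMatrix G (leavesS s)) rank-B rank-cut))

  module _ {a b : STree k} (uq : Unique (leavesS a ++ leavesS b))
           {n′ G′} {B′ : Mat (#leaves a + #leaves b) n′} (ind : Induced (node2 a b) G′ B′) where
    open Induced ind

    private
      σ : Fin (#leaves a) ⊎ Fin (#leaves b) → Fin (#leaves a + #leaves b)
      σ = join (#leaves a) (#leaves b)

      leafAt-σ₁ : ∀ i → leafAt (node2 a b) (σ (inj₁ i)) ≡ leafAt a i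
      leafAt-σ₁ = lookup-++ˡ (leafAt a) (leafAt b)

      leafAt-σ₂ : ∀ i → leafAt (node2 a b) (σ (inj₂ i)) ≡ leafAt b i
      leafAt-σ₂ = lookup-++ʳ (leafAt a) (leafAt b)

    Induced-left : Induced a (restrict₁ σ G′) (rows₁ σ B′ ∣∣ between σ G′)
    Induced-left = induced (port V.++ inj₂ ∘ leafAt b)
      (λ i j → trans (graph≡ _ _) (cong₂ G (leafAt-σ₁ i) (leafAt-σ₁ j)))
      (λ i j → boundary i (splitAt n′ j)) (outside′ ∘ splitAt n′)
      where
      boundary : ∀ i q → [ B′ (σ (inj₁ i)) , between σ G′ i ]′ q ≡ fullBoundary (leafAt a i) ([ port , inj₂ ∘ leafAt b ]′ q)
      boundary i (inj₁ j) = trans (boundary≡ _ j) (cong (λ x → fullBoundary x (port j)) (leafAt-σ₁ i))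
      boundary i (inj₂ j) = trans (edges≡ _ _) (cong₂ (edges G) (leafAt-σ₁ i) (leafAt-σ₂ j))

      outside′ : ∀ q → Outside (leavesS a) ([ port , inj₂ ∘ leafAt b ]′ q)
      outside′ (inj₁ j) = Outside-++⁻ˡ (leavesS a) (port j) (outside j)
      outside′ (inj₂ j) = Unique-++⇒disjoint (leavesS a) uq (leafAt-∈ b j)

    Induced-right : Induced b (restrict₂ σ G′) (rows₂ σ B′ ∣∣ transpose (between σ G′))
    Induced-right = induced (port V.++ inj₂ ∘ leafAt a)
      (λ i j → trans (graph≡ _ _) (cong₂ G (leafAt-σ₂ i) (leafAt-σ₂ j)))
      (λ i j → boundary i (splitAt n′ j)) (outside′ ∘ splitAt n′)
      where
      boundary : ∀ i q → [ B′ (σ (inj₂ i)) , transpose (between σ G′) i ]′ q ≡ fullBoundary (leafAt b i) ([ port , inj₂ ∘ leafAt a ]′ q)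
      boundary i (inj₁ j) = trans (boundary≡ _ j) (cong (λ x → fullBoundary x (port j)) (leafAt-σ₂ i))
      boundary i (inj₂ j) = trans (edges≡ _ _) (trans (cong₂ (edges G) (leafAt-σ₁ j) (leafAt-σ₂ i)) (edges-comm G _ _))

      outside′ : ∀ q → Outside (leavesS b) ([ port , inj₂ ∘ leafAt a ]′ q)
      outside′ (inj₁ j) = Outside-++⁻ʳ (leavesS a) (port j) (outside j)
      outside′ (inj₂ j) = λ leaf∈b → Unique-++⇒disjoint (leavesS a) uq leaf∈b (leafAt-∈ a j)

  module _ {w ρ : ℕ} {t : STree k} (rank-cut : ∀ s → s ⊑ t → RankAtMost (cutMatrix G (leavesS s)) w)
           (rank-B : RankAtMost B ρ) where

    build : ∀ s → s ⊑ t → Unique (leavesS s) → ∀ {n′ G′} {B′ : Mat (#leaves s) n′} → Induced s G′ B′ →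
      Σ (IRD (#leaves s) n′ G′ B′) λ T → IRDWidthAtMost T (w + ρ)
    build (leaf _) s⊑t uq ind = single , Induced-rank uq (rank-cut _ s⊑t) rank-B ind
    build (node1 s) s⊑t uq (induced port graph≡ boundary≡ outside) =
      build s (⊑-trans (in1 here) s⊑t) uq (induced port graph≡ boundary≡ outside)
    build (node2 a b) s⊑t uq ind
      with build a (⊑-trans (in2ˡ here) s⊑t) (Unique-++⁻ˡ (leavesS a) uq) (Induced-left uq ind)
         | build b (⊑-trans (in2ʳ here) s⊑t) (Unique-++⁻ʳ (leavesS a) uq) (Induced-right uq ind)
    ... | T₁ , width₁ | T₂ , width₂ =
      split (#leaves a) (#leaves b) (join _ _) (join-bijective _ _) T₁ T₂ ,
      Induced-rank uq (rank-cut _ s⊑t) rank-B ind , width₁ , width₂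

  module _ {v : Fin k} {t : STree k} (v∉t : v ∉ leavesS t) where
    private
      σ : Fin 1 ⊎ Fin (#leaves t) → Fin k
      σ = enumerateRooted v t

    Induced-root : Induced t (restrict₂ σ G) (rows₂ σ B ∣∣ transpose (between σ G))
    Induced-root = induced (inj₁ V.++ λ _ → inj₂ v) (λ _ _ → refl)
      (λ i j → boundary i (splitAt n j)) (outside ∘ splitAt n)
      where
      boundary : ∀ i q → [ B (leafAt t i) , (λ _ → edges G v (leafAt t i)) ]′ q ≡ fullBoundary (leafAt t i) ([ inj₁ , (λ _ → inj₂ v) ]′ q)
      boundary i (inj₁ _) = refl
      boundary i (inj₂ _) = edges-comm G v (leafAt t i)

      outside : ∀ q → Outside (leavesS t) ([ inj₁ , (λ _ → inj₂ v) ]′ q)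
      outside (inj₁ _) = tt
      outside (inj₂ _) = v∉t

    -- A single row has rank at most 1; for rank 0, both B and the cut at t vanish.
    vertex-boundary-rank : ∀ {w ρ} → RankAtMost (cutMatrix G (leavesS t)) w → RankAtMost B ρ →
      RankAtMost (rows₁ σ B ∣∣ between σ G) (w + ρ)
    vertex-boundary-rank {w} {ρ} rank-cut rank-B = RankAtMost-row (w + ρ) (rows₁ σ B ∣∣ between σ G) λ w+ρ≡0 j → entry w+ρ≡0 (splitAt n j)
      where
      entry : w + ρ ≡ 0 → ∀ q → toℚ ([ B v , (λ i → edges G v (leafAt t i)) ]′ q) ≡ 0ℚ
      entry w+ρ≡0 (inj₁ j) = RankAtMost-zero B (subst (RankAtMost B) (ℕ.m+n≡0⇒n≡0 w w+ρ≡0) rank-B) v j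
      entry w+ρ≡0 (inj₂ i) = begin
        toℚ (edges G v (leafAt t i))                   ≡⟨ cong toℚ (edges-comm G v (leafAt t i)) ⟩
        toℚ (edges G (leafAt t i) v)                   ≡⟨ cong toℚ (cutMatrix-across G (leafAt-∈ t i) v∉t) ⟨
        toℚ (cutMatrix G (leavesS t) (leafAt t i) v)   ≡⟨ RankAtMost-zero (cutMatrix G (leavesS t)) rank-cut₀ (leafAt t i) v ⟩
        0ℚ                                             ∎
        where
        rank-cut₀ : RankAtMost (cutMatrix G (leavesS t)) 0
        rank-cut₀ = subst (RankAtMost (cutMatrix G (leavesS t))) (ℕ.m+n≡0⇒m≡0 w w+ρ≡0) rank-cut

single-vertex : ∀ {k n r} {G : Mat k k} {B : Mat k n} → 1 ≡ k → RankAtMost B r →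
  Σ (IRD k n G B) λ T → IRDWidthAtMost T r
single-vertex refl rank-B = single , rank-B

proposition5p11 : ∀ {k n : ℕ} (G : Mat k k) (B : Mat k n) (Y : SubcubicTree k) →
    IsRankDecomposition Y →
    ∀ (w ρ : ℕ) → RDWidthAtMost G Y w → RankAtMost B ρ →
    Σ (IRD k n G B) (λ T → IRDWidthAtMost T (w + ρ))
proposition5p11 G B (single v) perm w ρ _ rank-B =
  single-vertex (trans (↭-length perm) (length-tabulate id)) (RankAtMost-mono B (ℕ.m≤n+m ρ w) rank-B)
proposition5p11 {k} {n} G B (rooted v t) perm w ρ rank-cut rank-B =
  split 1 (#leaves t) σ (enumerateRooted-bijective {v = v} {t} perm) single (proj₁ rest) ,
  RankAtMost-mono B (ℕ.m≤n+m ρ w) rank-B , vertex-boundary-rank {t = t} v∉t (rank-cut t here) rank-B , proj₂ rest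
  where
  open Construction G B
  σ : Fin 1 ⊎ Fin (#leaves t) → Fin k
  σ = enumerateRooted v t

  uq : Unique (v ∷ leavesS t)
  uq = Unique-resp-↭ (↭-sym perm) (allFin⁺ k)

  v∉t : v ∉ leavesS t
  v∉t = Unique[x∷xs]⇒x∉xs uq

  rest : Σ (IRD (#leaves t) (n + 1) (restrict₂ σ G) (rows₂ σ B ∣∣ transpose (between σ G))) λ T → IRDWidthAtMost T (w + ρ)
  rest = build {t = t} rank-cut rank-B t here (drop⁺ 1 uq) (Induced-root {t = t} v∉t)
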